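{- In the $(1:1)$ WMaker--WBreaker game on $E(K_n)$, if WMaker plays according to strategy $\mathcal{S}$, then, as long as $|U|\ge 2$, in every round $i\ge 2$, after WBreaker's move and before WMaker's move, the vertex $w$ at which WMaker finished her previous move satisfies $d_B(w,U)\le 2$; moreover, if $d_B(w,U)=2$, then WBreaker finished his move in round $i-1$ at the vertex $w$.
   Context: The $(1:1)$ WMaker--WBreaker game on $E(K_n)$: WMaker and WBreaker alternately claim one edge of $K_n$ per turn; both are walkers: at the first move a player chooses any starting vertex; when positioned at $v$, a player may only claim an edge incident with $v$ not previously claimed by the opponent, and its other endpoint becomes the new position. WBreaker starts; a round is a move of WBreaker followed by a move of WMaker. $M$ and $B$ denote the graphs of edges claimed so far by WMaker and WBreaker; $V(M)$ is the set of vertices incident with at least one WMaker edge, and $U=V(K_n)\setminus V(M)$. An edge is free if claimed by neither player. $d_B(x)$ is the degree of $x$ in $B$, and for $A\subseteq V$, $d_B(x,A)$ is the number of WBreaker edges from $x$ to $A$. Strategy $\mathcal{S}$ for WMaker: as her starting vertex she takes the vertex $v_1$ at which WBreaker finished his first move, and claims an edge $v_1u$ with $d_B(u)=0$ (ties arbitrary). In every later round, with current position $w$: if there is an edge $pq\in E(B)$ with $p,q\in U$, she claims $wp$ or $wq$, whichever is free; if both are free she chooses $wp$ if $d_B(p)>d_B(q)$ and $wq$ if $d_B(q)>d_B(p)$ (ties arbitrary). If no such edge exists, then, as long as $|U|\ge 3$, she claims a free edge $wu$ with $u\in U$ and $d_B(u)=\max\{d_B(v):v\in U\}$ (ties arbitrary);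 if all free edges $wu$ are such that $d_B(u)=0$ for all $u\in U$, she claims an arbitrary free edge $wu$. -}

module Defs where

open import Data.Nat using (ℕ; zero; suc; _≤_; _<_)
open import Data.Fin using (Fin; _≟_)
open import Data.Product using (Σ; _×_; _,_)
open import Data.Sum using (_⊎_)
open import Data.List using (List; []; _∷_; map; filter; length; upTo; allFin; concatMap)
open import Data.List.Relation.Unary.Any using (Any; any?)
open import Data.List.Membership.Propositional using (_∈_)
open import Relation.Nullary using (¬_; Dec)
open import Relation.Nullary.Decidable using (_×-dec_; _⊎-dec_; ¬?)
open import Relation.Binary.PropositionalEquality using (_≡_; _≢_)

-- Vertices of K_n are Fin n. An edge xy of K_n is represented by an
-- ordered pair (x , y); (x , y) and (y , x) denote the same edge.
Edge : ℕ → Set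
Edge n = Fin n × Fin n

SameEdge : {n : ℕ} → Edge n → Edge n → Set
SameEdge (x , y) (u , v) = (x ≡ u × y ≡ v) ⊎ (x ≡ v × y ≡ u)

sameEdge? : {n : ℕ} (e f : Edge n) → Dec (SameEdge e f)
sameEdge? (x , y) (u , v) = ((x ≟ u) ×-dec (y ≟ v)) ⊎-dec ((x ≟ v) ×-dec (y ≟ u))

_∈E_ : {n : ℕ} → Edge n → List (Edge n) → Set
e ∈E L = Any (SameEdge e) L

_∈E?_ : {n : ℕ} (e : Edge n) (L : List (Edge n)) → Dec (e ∈E L)
e ∈E? L = any? (sameEdge? e) L

-- A walk is a sequence of positions s 0, s 1, s 2, ...  (s 0 = starting
-- vertex, s j = position after the j-th move).  The edges claimed in the
-- first k moves are s j s (j+1) for j < k.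
walkEdges : {n : ℕ} → (ℕ → Fin n) → ℕ → List (Edge n)
walkEdges s k = map (λ j → s j , s (suc j)) (upTo k)

walkVerts : {n : ℕ} → (ℕ → Fin n) → ℕ → List (Fin n)
walkVerts s k = concatMap (λ j → s j ∷ s (suc j) ∷ []) (upTo k)

Ulist : {n : ℕ} → (ℕ → Fin n) → ℕ → List (Fin n)
Ulist {n} m k = filter (λ x → ¬? (any? (x ≟_) (walkVerts m k))) (allFin n)

degB : {n : ℕ} → List (Edge n) → Fin n → ℕ
degB {n} B x = length (filter (λ y → (x , y) ∈E? B) (allFin n))

-- d_B(x, A) : number of B-edges from x to A  (A duplicate-free)
degBA : {n : ℕ} → List (Edge n) → Fin n → List (Fin n) → ℕ
degBA B x A = length (filter (λ y → (x , y) ∈E? B) A)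

Free : {n : ℕ} → List (Edge n) → List (Edge n) → Edge n → Set
Free B M e = ¬ (e ∈E B) × ¬ (e ∈E M)

-- Rounds are numbered 1,2,...; round (suc j) consists of WBreaker's move
-- b j → b (suc j) followed by WMaker's move m j → m (suc j).

-- legality of WBreaker's move in round (suc j): a walker move along an
-- edge of K_n (distinct endpoints) not claimed by WMaker (in rounds ≤ j)
BreakerLegal : {n : ℕ} → (b m : ℕ → Fin n) → ℕ → Set
BreakerLegal b m j = (b j ≢ b (suc j)) × ¬ ((b j , b (suc j)) ∈E walkEdges m j)

-- legality of WMaker's move in round (suc j) (WBreaker has made suc j moves)
MakerLegal : {n : ℕ} → (b m : ℕ → Fin n) → ℕ → Set
MakerLegal b m j = (m j ≢ m (suc j)) × ¬ ((m j , m (suc j)) ∈E walkEdges b (suc j))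

SMove : {n : ℕ} → (b m : ℕ → Fin n) → ℕ → Set
SMove b m zero =
  (m 0 ≡ b 1) × (degB (walkEdges b 1) (m 1) ≡ 0)
SMove {n} b m (suc j) = RuleA ⊎ RuleB
  where
  B : List (Edge n)
  B = walkEdges b (suc (suc j))
  M : List (Edge n)
  M = walkEdges m (suc j)
  U : List (Fin n)
  U = Ulist m (suc j)
  w : Fin n
  w = m (suc j)
  t : Fin n
  t = m (suc (suc j))
  EdgeInU : Set
  EdgeInU = Σ (Fin n) λ p → Σ (Fin n) λ q → p ∈ U × q ∈ U × (p , q) ∈E B
  RuleA : Set
  RuleA = Σ (Fin n) λ p → Σ (Fin n) λ q →
            p ∈ U × q ∈ U × (p , q) ∈E B × t ≡ p × Free B M (w , p)
            × (Free B M (w , q) → degB B q ≤ degB B p)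
  RuleB : Set
  RuleB = ¬ EdgeInU × 3 ≤ length U × t ∈ U × Free B M (w , t)
          × ((∀ v → v ∈ U → degB B v ≤ degB B t)
             ⊎ (∀ u → u ∈ U → Free B M (w , u) → degB B u ≡ 0))

-- The heart of the matter is an invariant: after each WMaker move, U spans no
-- WBreaker edge.  A new WBreaker edge inside U is exactly the situation of the
-- first rule of S, which moves WMaker onto one of its endpoints and so removes
-- it from U, while the second rule is only used when U spans no edge at all.
-- At the start of round i, WMaker's position w was in U before her last move,
-- so by the invariant no WBreaker edge older than round i - 1 joins w to U.
-- The only candidates are WBreaker's last two edges; they share the vertex he
-- reached in round i - 1, so w has at most two neighbours in U, and two only if
-- w is that shared vertex.
module Submission where

open import Defs
open import Data.Nat using (ℕ; zero; suc; _≤_; _<_; z≤n; s≤s)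
open import Data.Nat.Properties using (m<1+n⇒m<n∨m≡n; ≤-refl; n<1+n; m<n⇒m<1+n)
open import Data.Fin using (Fin; _≟_)
open import Data.Product using (∃-syntax; _×_; _,_; proj₂)
open import Data.Sum using (_⊎_; inj₁; inj₂; [_,_]′)
open import Data.Empty using (⊥; ⊥-elim)
open import Data.List using (List; []; _∷_; [_]; length; filter; upTo; allFin)
open import Data.List.Relation.Unary.Any using (here; there; any?)
open import Data.List.Relation.Unary.All using (_∷_)
open import Data.List.Relation.Unary.AllPairs using (_∷_)
open import Data.List.Relation.Unary.Any.Properties using (map⁻; map⁺)
open import Data.List.Membership.Propositional using (_∈_; _∉_; find; lose)
open import Data.List.Membership.Propositional.Properties
  using (∈-upTo⁺; ∈-upTo⁻; ∈-concatMap⁺; ∈-concatMap⁻; ∈-filter⁺; ∈-filter⁻; ∈-allFin)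
open import Data.List.Relation.Binary.Subset.Propositional using (_⊆_)
open import Data.List.Relation.Unary.Unique.Propositional using (Unique)
open import Data.List.Relation.Unary.Unique.Propositional.Properties using (allFin⁺; filter⁺)
open import Function using (_∘_; flip)
open import Relation.Nullary using (¬_; yes; no; contradiction)
open import Relation.Nullary.Decidable using (¬?)
open import Relation.Binary.PropositionalEquality using (_≡_; _≢_; refl; sym; trans; subst)

private
  variable
    A : Set
    n j k : ℕ
    a c x y z : A
    s b m : ℕ → Fin n

no-three-distinct-in-pair : x ∈ a ∷ c ∷ [] → y ∈ a ∷ c ∷ [] → z ∈ a ∷ c ∷ []
                          → x ≢ y → x ≢ z → y ≢ z → ⊥
no-three-distinct-in-pair (here refl)         (here refl)         _ x≢y _ _ = x≢y refl
no-three-distinct-in-pair (there (here refl)) (there (here refl)) _ x≢y _ _ = x≢y refl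
no-three-distinct-in-pair (here refl)         _ (here refl)         _ x≢z _ = x≢z refl
no-three-distinct-in-pair (there (here refl)) _ (there (here refl)) _ x≢z _ = x≢z refl
no-three-distinct-in-pair _ (here refl)         (here refl)         _ _ y≢z = y≢z refl
no-three-distinct-in-pair _ (there (here refl)) (there (here refl)) _ _ y≢z = y≢z refl

unique⊆pair⇒length≤2 : {xs : List A} → Unique xs → xs ⊆ a ∷ c ∷ [] → length xs ≤ 2
unique⊆pair⇒length≤2 {xs = []}          _ _ = z≤n
unique⊆pair⇒length≤2 {xs = _ ∷ []}      _ _ = s≤s z≤n
unique⊆pair⇒length≤2 {xs = _ ∷ _ ∷ []}  _ _ = s≤s (s≤s z≤n)
unique⊆pair⇒length≤2 {xs = _ ∷ _ ∷ _ ∷ _} ((x≢y ∷ x≢z ∷ _) ∷ (y≢z ∷ _) ∷ _) xs⊆ =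
  ⊥-elim (no-three-distinct-in-pair (xs⊆ (here refl)) (xs⊆ (there (here refl)))
                                    (xs⊆ (there (there (here refl)))) x≢y x≢z y≢z)

unique⊆singleton⇒length≤1 : {xs : List A} → Unique xs → xs ⊆ [ a ] → length xs ≤ 1
unique⊆singleton⇒length≤1 {xs = []}     _ _ = z≤n
unique⊆singleton⇒length≤1 {xs = _ ∷ []} _ _ = s≤s z≤n
unique⊆singleton⇒length≤1 {xs = _ ∷ _ ∷ _} ((x≢y ∷ _) ∷ _) xs⊆
  with xs⊆ (here refl) | xs⊆ (there (here refl))
... | here refl | here refl = contradiction refl x≢y

sameEdge-endpoint : {p q p′ q′ : Fin n} {e : Edge n}
                  → SameEdge (p , q) e → SameEdge (p′ , q′) e → p′ ≡ p ⊎ p′ ≡ q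
sameEdge-endpoint (inj₁ (refl , refl)) (inj₁ (refl , refl)) = inj₁ refl
sameEdge-endpoint (inj₁ (refl , refl)) (inj₂ (refl , refl)) = inj₂ refl
sameEdge-endpoint (inj₂ (refl , refl)) (inj₁ (refl , refl)) = inj₂ refl
sameEdge-endpoint (inj₂ (refl , refl)) (inj₂ (refl , refl)) = inj₁ refl

opposite : Fin n → Edge n → Fin n
opposite w (a , c) with w ≟ a
... | yes _ = c
... | no  _ = a

sameEdge⇒opposite : {w y : Fin n} {e : Edge n} → SameEdge (w , y) e → y ≡ opposite w e
sameEdge⇒opposite {w = w} {e = a , c} w,y≈e with w ≟ a | w,y≈e
... | yes _   | inj₁ (_ , y≡c)         = y≡c
... | yes w≡a | inj₂ (w≡c , y≡a)       = trans y≡a (trans (sym w≡a) w≡c)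
... | no  w≢a | inj₁ (w≡a , _)         = contradiction w≡a w≢a
... | no  _   | inj₂ (_ , y≡a)         = y≡a

sameEdge⇒≡₁ : {w y a c : Fin n} → SameEdge (w , y) (a , c) → w ≢ a → y ≡ a
sameEdge⇒≡₁ (inj₁ (w≡a , _)) w≢a = contradiction w≡a w≢a
sameEdge⇒≡₁ (inj₂ (_ , y≡a)) _   = y≡a

sameEdge⇒≡₂ : {w y a c : Fin n} → SameEdge (w , y) (a , c) → w ≢ c → y ≡ c
sameEdge⇒≡₂ (inj₁ (_ , y≡c)) _   = y≡c
sameEdge⇒≡₂ (inj₂ (w≡c , _)) w≢c = contradiction w≡c w≢c

∈-walkEdges⁻ : {e : Edge n} → e ∈E walkEdges s k → ∃[ j ] j < k × SameEdge e (s j , s (suc j))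
∈-walkEdges⁻ e∈ with j , j∈ , e≈ ← find (map⁻ e∈) = j , ∈-upTo⁻ j∈ , e≈

∈-walkEdges⁺ : {e : Edge n} → j < k → SameEdge e (s j , s (suc j)) → e ∈E walkEdges s k
∈-walkEdges⁺ j<k e≈ = map⁺ (lose (∈-upTo⁺ j<k) e≈)

∈-walkEdges-suc⁻ : {e : Edge n} → e ∈E walkEdges s (suc k)
                 → e ∈E walkEdges s k ⊎ SameEdge e (s k , s (suc k))
∈-walkEdges-suc⁻ e∈ with j , j<1+k , e≈ ← ∈-walkEdges⁻ e∈ | m<1+n⇒m<n∨m≡n j<1+k
... | inj₁ j<k  = inj₁ (∈-walkEdges⁺ j<k e≈)
... | inj₂ refl = inj₂ e≈

∈-walkVerts⁻ : (s : ℕ → Fin n) (k : ℕ) {x : Fin n}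
             → x ∈ walkVerts s k → ∃[ j ] j < k × (x ≡ s j ⊎ x ≡ s (suc j))
∈-walkVerts⁻ s k x∈ with find (∈-concatMap⁻ (λ j → s j ∷ s (suc j) ∷ []) {xs = upTo k} x∈)
... | j , j∈ , here x≡         = j , ∈-upTo⁻ j∈ , inj₁ x≡
... | j , j∈ , there (here x≡) = j , ∈-upTo⁻ j∈ , inj₂ x≡

∈-walkVerts⁺ : (s : ℕ → Fin n) (k : ℕ) {x : Fin n}
             → j < k → (x ≡ s j ⊎ x ≡ s (suc j)) → x ∈ walkVerts s k
∈-walkVerts⁺ s k j<k x≡ =
  ∈-concatMap⁺ (λ j → s j ∷ s (suc j) ∷ []) {xs = upTo k}
    (lose (∈-upTo⁺ j<k) ([ here , there ∘ here ]′ x≡))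

walkVerts-suc⁺ : (s : ℕ → Fin n) (k : ℕ) → walkVerts s k ⊆ walkVerts s (suc k)
walkVerts-suc⁺ s k x∈ with j , j<k , x≡ ← ∈-walkVerts⁻ s k x∈ =
  ∈-walkVerts⁺ s (suc k) (m<n⇒m<1+n j<k) x≡

∈-Ulist⁻ : (m : ℕ → Fin n) (k : ℕ) {x : Fin n} → x ∈ Ulist m k → x ∉ walkVerts m k
∈-Ulist⁻ {n = n} m k = proj₂ ∘ ∈-filter⁻ (λ x → ¬? (any? (x ≟_) (walkVerts m k))) {xs = allFin n}

∈-Ulist⁺ : (m : ℕ → Fin n) (k : ℕ) {x : Fin n} → x ∉ walkVerts m k → x ∈ Ulist m k
∈-Ulist⁺ m k {x} = ∈-filter⁺ (λ x → ¬? (any? (x ≟_) (walkVerts m k))) (∈-allFin x)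

Ulist-suc⊆ : (m : ℕ → Fin n) (k : ℕ) → Ulist m (suc k) ⊆ Ulist m k
Ulist-suc⊆ m k x∈ = ∈-Ulist⁺ m k (∈-Ulist⁻ m (suc k) x∈ ∘ walkVerts-suc⁺ m k)

Ulist-unique : (m : ℕ → Fin n) (k : ℕ) → Unique (Ulist m k)
Ulist-unique {n = n} m k = filter⁺ (λ x → ¬? (any? (x ≟_) (walkVerts m k))) (allFin⁺ n)

start∉Ulist : (m : ℕ → Fin n) → j < k → m j ∉ Ulist m k
start∉Ulist {k = k} m j<k m[j]∈ = ∈-Ulist⁻ m k m[j]∈ (∈-walkVerts⁺ m k j<k (inj₁ refl))

end∉Ulist : (m : ℕ → Fin n) → j < k → m (suc j) ∉ Ulist m k
end∉Ulist {k = k} m j<k m[1+j]∈ = ∈-Ulist⁻ m k m[1+j]∈ (∈-walkVerts⁺ m k j<k (inj₂ refl))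

FollowsS : (b m : ℕ → Fin n) → ℕ → Set
FollowsS b m k = ∀ j → j < k → SMove b m j

FollowsS-pred : FollowsS b m (suc k) → FollowsS b m k
FollowsS-pred S j j<k = S j (m<n⇒m<1+n j<k)

target∈Ulist : SMove b m k → m (suc k) ∈ Ulist m k
target∈Ulist {m = m} {k = zero} _ = ∈-Ulist⁺ m 0 λ ()
target∈Ulist {m = m} {k = suc k} (inj₁ (_ , _ , p∈U , _ , _ , t≡p , _)) =
  subst (_∈ Ulist m (suc k)) (sym t≡p) p∈U
target∈Ulist {k = suc k} (inj₂ (_ , _ , t∈U , _)) = t∈U

Independent : List (Edge n) → List (Fin n) → Set
Independent B X = ∀ {p q} → p ∈ X → q ∈ X → ¬ (p , q) ∈E B

∉-endpoints : {X : List A} → x ∉ X → x ≡ a ⊎ x ≡ c → a ∈ X → c ∈ X → ⊥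
∉-endpoints x∉X (inj₁ refl) a∈X _   = x∉X a∈X
∉-endpoints x∉X (inj₂ refl) _   c∈X = x∉X c∈X

lastBreakerEdge⊈U : Independent (walkEdges b k) (Ulist m k) → SMove b m k
                  → {p q : Fin n} → (p , q) ∈E walkEdges b (suc k)
                  → SameEdge (p , q) (b k , b (suc k))
                  → p ∈ Ulist m (suc k) → q ∈ Ulist m (suc k) → ⊥
lastBreakerEdge⊈U {b = b} {k = zero} {m = m} _ (m₀≡b₁ , _) _ pq≈ =
  ∉-endpoints b₁∉U (sameEdge-endpoint pq≈ (inj₂ (refl , refl)))
  where
  b₁∉U : b 1 ∉ Ulist m 1
  b₁∉U = start∉Ulist m (n<1+n 0) ∘ subst (_∈ Ulist m 1) (sym m₀≡b₁)
lastBreakerEdge⊈U {k = suc k} {m = m} _ (inj₂ (noEdgeInU , _)) pq∈B _ p∈U q∈U =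
  noEdgeInU (_ , _ , Ulist-suc⊆ m (suc k) p∈U , Ulist-suc⊆ m (suc k) q∈U , pq∈B)
lastBreakerEdge⊈U {k = suc k} {m = m} indep
                  (inj₁ (p′ , q′ , p′∈U , q′∈U , p′q′∈B , t≡p′ , _)) _ pq≈
  with ∈-walkEdges-suc⁻ p′q′∈B
... | inj₁ p′q′∈B-old = contradiction p′q′∈B-old (indep p′∈U q′∈U)
... | inj₂ p′q′≈      = ∉-endpoints p′∉U (sameEdge-endpoint pq≈ p′q′≈)
  where
  p′∉U : p′ ∉ Ulist m (suc (suc k))
  p′∉U = end∉Ulist m ≤-refl ∘ subst (_∈ Ulist m (suc (suc k))) (sym t≡p′)

U-independent : FollowsS b m k → Independent (walkEdges b k) (Ulist m k)
U-independent {k = zero} _ _ _ ()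
U-independent {m = m} {k = suc k} S p∈U q∈U pq∈B with ∈-walkEdges-suc⁻ pq∈B
... | inj₁ pq∈B-old =
  U-independent (FollowsS-pred S) (Ulist-suc⊆ m k p∈U) (Ulist-suc⊆ m k q∈U) pq∈B-old
... | inj₂ pq≈ =
  lastBreakerEdge⊈U (U-independent (FollowsS-pred S)) (S k ≤-refl) pq∈B pq≈ p∈U q∈U

U-neighbour⇒lastTwoEdges : FollowsS b m (suc k) → y ∈ Ulist m (suc k)
                         → (m (suc k) , y) ∈E walkEdges b (suc (suc k))
                         → SameEdge (m (suc k) , y) (b k , b (suc k))
                           ⊎ SameEdge (m (suc k) , y) (b (suc k) , b (suc (suc k)))
U-neighbour⇒lastTwoEdges {m = m} {k = k} S y∈U wy∈B with ∈-walkEdges-suc⁻ wy∈B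
... | inj₂ wy≈ = inj₂ wy≈
... | inj₁ wy∈B′ with ∈-walkEdges-suc⁻ wy∈B′
...   | inj₂ wy≈ = inj₁ wy≈
...   | inj₁ wy∈B-old =
  contradiction wy∈B-old
    (U-independent (FollowsS-pred S) (target∈Ulist (S k ≤-refl)) (Ulist-suc⊆ m k y∈U))

neighbours : List (Edge n) → Fin n → List (Fin n) → List (Fin n)
neighbours B x X = filter (λ y → (x , y) ∈E? B) X

∈-neighbours⁻ : {B : List (Edge n)} {X : List (Fin n)} {x y : Fin n}
              → y ∈ neighbours B x X → y ∈ X × (x , y) ∈E B
∈-neighbours⁻ {B = B} {X = X} {x = x} = ∈-filter⁻ (λ y → (x , y) ∈E? B) {xs = X}

neighbours-unique : {B : List (Edge n)} {X : List (Fin n)} {x : Fin n}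
                  → Unique X → Unique (neighbours B x X)
neighbours-unique {B = B} {x = x} = filter⁺ (λ y → (x , y) ∈E? B)

corollary2 : (n : ℕ) (b m : ℕ → Fin n) (k : ℕ) → 1 ≤ k
    → (∀ j → j < suc k → BreakerLegal b m j)
    → (∀ j → j < k → MakerLegal b m j × SMove b m j)
    → 2 ≤ length (Ulist m k)
    → degBA (walkEdges b (suc k)) (m k) (Ulist m k) ≤ 2
      × (degBA (walkEdges b (suc k)) (m k) (Ulist m k) ≡ 2 → b k ≡ m k)
corollary2 n b m zero () _ _ _
corollary2 n b m (suc k) _ _ legal _ = degree≤2 , degree≡2⇒breakerAtW
  where
  S : FollowsS b m (suc k)
  S j j<1+k = proj₂ (legal j j<1+k)

  w : Fin n
  w = m (suc k)

  N : List (Fin n)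
  N = neighbours (walkEdges b (suc (suc k))) w (Ulist m (suc k))

  N-unique : Unique N
  N-unique = neighbours-unique (Ulist-unique m (suc k))

  lastTwo : ∀ {y} → y ∈ N → SameEdge (w , y) (b k , b (suc k))
                            ⊎ SameEdge (w , y) (b (suc k) , b (suc (suc k)))
  lastTwo y∈N = let y∈U , wy∈B = ∈-neighbours⁻ y∈N in U-neighbour⇒lastTwoEdges S y∈U wy∈B

  degree≤2 : length N ≤ 2
  degree≤2 = unique⊆pair⇒length≤2 N-unique
    ([ here ∘ sameEdge⇒opposite , there ∘ here ∘ sameEdge⇒opposite ]′ ∘ lastTwo)

  degree≡2⇒breakerAtW : length N ≡ 2 → b (suc k) ≡ w
  degree≡2⇒breakerAtW |N|≡2 with w ≟ b (suc k)
  ... | yes w≡b = sym w≡b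
  ... | no  w≢b = contradiction (subst (_≤ 1) |N|≡2 |N|≤1) λ { (s≤s ()) }
    where
    |N|≤1 : length N ≤ 1
    |N|≤1 = unique⊆singleton⇒length≤1 N-unique
      (here ∘ [ flip sameEdge⇒≡₂ w≢b , flip sameEdge⇒≡₁ w≢b ]′ ∘ lastTwo)
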